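{- Let $G$ be an infinite, finitely colored group. Assume that $a_1,a_2,\dots\in G$ are distinct elements such that the set $$\widehat{\mathrm{FP}}(a_1,a_2,\dots)=\{a_{i_1}a_{i_2}\cdots a_{i_m} : m\ge 1,\ i_1,i_2,\dots,i_m \text{ are distinct}\}$$ is almost-monochromatic. Then there is a subsequence $a_{i_1},a_{i_2},\dots$ (with $i_1<i_2<\cdots$) of $a_1,a_2,\dots$ such that $\widehat{\mathrm{FP}}(a_{i_1},a_{i_2},\dots)$ is monochromatic.
   Context: A finitely colored set is one in which each element is assigned one of finitely many colors. A colored set $A$ is monochromatic if all members of $A$ have the same color, and almost-monochromatic if all but finitely many members of $A$ have the same color. -}

module Defs where

open import Level using (Level; _⊔_)
open import Data.Nat using (ℕ; _<_; _≥_)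
open import Data.Fin using (Fin)
open import Data.List using (List; []; _∷_; foldr; length)
open import Data.List.Relation.Unary.Unique.Propositional using (Unique)
open import Data.List.Relation.Unary.Any using (Any)
open import Data.Product using (Σ; ∃; _×_; _,_)
open import Data.Sum using (_⊎_)
open import Relation.Binary.PropositionalEquality using (_≡_)
open import Relation.Nullary using (¬_)
open import Algebra.Bundles using (Group)

module _ {c ℓ : Level} (G : Group c ℓ) where
  open Group G renaming (Carrier to ∣G∣)

  record Colouring (k : ℕ) : Set (c ⊔ ℓ) where
    field
      colour    : ∣G∣ → Fin k
      colour-≈  : ∀ {x y} → x ≈ y → colour x ≡ colour y

  Distinct : (ℕ → ∣G∣) → Set ℓ
  Distinct a = ∀ i j → a i ≈ a j → i ≡ j

  Admissible : List ℕ → Set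
  Admissible is = Unique is × length is ≥ 1

  prod : (ℕ → ∣G∣) → List ℕ → ∣G∣
  prod a is = foldr (λ i acc → a i ∙ acc) ε is

  InFPhat : (ℕ → ∣G∣) → ∣G∣ → Set ℓ
  InFPhat a x = Σ (List ℕ) λ is → Admissible is × x ≈ prod a is

  Monochromatic : {k : ℕ} → Colouring k → (ℕ → ∣G∣) → Set (c ⊔ ℓ)
  Monochromatic {k} χ a =
    Σ (Fin k) λ col → ∀ x → InFPhat a x → Colouring.colour χ x ≡ col

  AlmostMonochromatic : {k : ℕ} → Colouring k → (ℕ → ∣G∣) → Set (c ⊔ ℓ)
  AlmostMonochromatic {k} χ a =
    Σ (Fin k) λ col → Σ (List ∣G∣) λ F →
      ∀ x → InFPhat a x → Colouring.colour χ x ≡ col ⊎ Any (x ≈_) F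

  Infinite : Set (c ⊔ ℓ)
  Infinite = Σ (ℕ → ∣G∣) Distinct

StrictlyIncreasing : (ℕ → ℕ) → Set
StrictlyIncreasing f = ∀ n → f n < f (Data.Nat.suc n)

module Submission where

-- We choose the subsequence a ∘ i greedily, keeping the invariant that every
-- product of distinct members of the chosen prefix has colour col.  To pick
-- the m-th term we only need to check the finitely many duplicate-free index
-- lists t that use position m and otherwise positions < m.  For a fixed t,
-- group cancellation and distinctness of the aᵢ make n ↦ (the product along t
-- with a_n in position m) injective, and each miscoloured product lies in F;
-- so at most |F| candidates n are bad for t.  A pigeonhole argument over
-- |Ts|·|F| + 1 fresh candidates therefore finds an n good for every t.

open import Defs
open import Level using (Level)
open import Data.Nat using (ℕ; zero; suc; _<_; _≤_; _+_; _*_; _⊔_; z≤n; s≤s; s≤s⁻¹; _<?_; _≟_)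
open import Data.Nat.Properties
open import Data.Fin using (Fin) renaming (_≟_ to _≟ᶠ_)
open import Data.Fin.Properties using (injective⇒≤)
open import Data.List using (List; []; _∷_; length; map; filter; lookup; upTo; cartesianProductWith)
open import Data.List.Properties using (length-upTo; foldr-map)
open import Data.List.Relation.Unary.All as All using (All; []; _∷_; all?)
import Data.List.Relation.Unary.All.Properties as AllP
open import Data.List.Relation.Unary.Any as Any using (Any; here; there)
open import Data.List.Relation.Unary.Any.Properties using (lookup-result)
open import Data.List.Relation.Unary.Unique.Propositional using (Unique; []; _∷_)
import Data.List.Relation.Unary.Unique.Propositional.Properties as UniqueP
open import Data.List.Relation.Unary.Unique.DecPropositional _≟_ using (unique?)
open import Data.List.Membership.Propositional using (_∈_)
open import Data.List.Membership.DecPropositional _≟_ using (_∈?_)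
open import Data.List.Membership.Propositional.Properties
  using (∈-lookup; ∈-filter⁺; ∈-filter⁻; ∈-upTo⁺; ∈-cartesianProductWith⁺)
open import Data.Product using (Σ; ∃; _×_; _,_; proj₁; proj₂)
open import Data.Sum using (_⊎_; inj₁; inj₂)
open import Data.Empty using (⊥-elim)
open import Relation.Nullary using (yes; no; _×-dec_)
open import Relation.Unary using (Pred; Decidable; ∁)
open import Relation.Unary.Properties using (∁?)
open import Relation.Binary.PropositionalEquality
  using (_≡_; _≢_; refl; sym; trans; cong; cong₂; subst; subst₂; module ≡-Reasoning)
open import Function using (_∘_)
open import Algebra.Bundles using (Group)

-- Counting in duplicate-free lists

unique-lookup-injective : ∀ {a} {A : Set a} {xs : List A} → Unique xs →
  ∀ {i j} → lookup xs i ≡ lookup xs j → i ≡ j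
unique-lookup-injective (_ ∷ _) {Fin.zero} {Fin.zero} _ = refl
unique-lookup-injective (x∉xs ∷ _) {Fin.zero} {Fin.suc j} eq =
  ⊥-elim (All.lookup x∉xs (∈-lookup j) eq)
unique-lookup-injective (x∉xs ∷ _) {Fin.suc i} {Fin.zero} eq =
  ⊥-elim (All.lookup x∉xs (∈-lookup i) (sym eq))
unique-lookup-injective (_ ∷ u) {Fin.suc i} {Fin.suc j} eq =
  cong Fin.suc (unique-lookup-injective u eq)

unique-covered-≤ : ∀ {a b r} {A : Set a} {B : Set b} (R : A → B → Set r) →
  (∀ {x x' y} → R x y → R x' y → x ≡ x') →
  ∀ {xs L} → Unique xs → All (λ x → Any (R x) L) xs → length xs ≤ length L
unique-covered-≤ R R-functional {xs} {L} u cover = injective⇒≤ slot-injective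
  where
  witness : ∀ i → Any (R (lookup xs i)) L
  witness i = All.lookup cover (∈-lookup i)

  slot : Fin (length xs) → Fin (length L)
  slot i = Any.index (witness i)

  slot-injective : ∀ {i j} → slot i ≡ slot j → i ≡ j
  slot-injective {i} {j} eq = unique-lookup-injective u
    (R-functional (lookup-result (witness i))
      (subst (R (lookup xs j) ∘ lookup L) (sym eq) (lookup-result (witness j))))

unique-below-length : ∀ {m ts} → Unique ts → All (_< m) ts → length ts ≤ m
unique-below-length {m} u ts<m =
  subst (_ ≤_) (length-upTo m)
    (unique-covered-≤ _≡_ (λ e e' → trans e (sym e')) u (All.map ∈-upTo⁺ ts<m))

boundedLists : ℕ → ℕ → List (List ℕ)
boundedLists zero    m = [] ∷ []
boundedLists (suc L) m = [] ∷ cartesianProductWith _∷_ (upTo m) (boundedLists L m)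

∈-boundedLists : ∀ L m ts → length ts ≤ L → All (_< m) ts → ts ∈ boundedLists L m
∈-boundedLists zero    m []       _         _          = here refl
∈-boundedLists (suc L) m []       _         _          = here refl
∈-boundedLists (suc L) m (j ∷ ts) (s≤s len) (j<m ∷ ts<m) =
  there (∈-cartesianProductWith⁺ _∷_ (∈-upTo⁺ j<m) (∈-boundedLists L m ts len ts<m))

unique-map-on : ∀ {a b q} {A : Set a} {B : Set b} {Q : Pred A q} {g : A → B} →
  (∀ {x y} → Q x → Q y → g x ≡ g y → x ≡ y) →
  ∀ {xs} → All Q xs → Unique xs → Unique (map g xs)
unique-map-on inj []         []           = []
unique-map-on inj (qx ∷ qxs) (x∉xs ∷ u) =
  AllP.map⁺ (All.zipWith (λ { (x≢y , qy) gx≡gy → x≢y (inj qx qy gx≡gy) }) (x∉xs , qxs))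
  ∷ unique-map-on inj qxs u

map-nonempty : ∀ {a b} {A : Set a} {B : Set b} (g : A → B) {x xs} → x ∈ xs → 1 ≤ length (map g xs)
map-nonempty g {xs = _ ∷ _} _ = s≤s z≤n

upperBound : (ts : List ℕ) → ∃ λ M → All (_< M) ts
upperBound []       = 0 , []
upperBound (j ∷ ts) with M , ts<M ← upperBound ts =
  suc (j ⊔ M) , s≤s (m≤m⊔n j M) ∷ All.map (λ k<M → m<n⇒m<1+n (<-≤-trans k<M (m≤n⊔m j M))) ts<M

length-filter-split : ∀ {a p} {A : Set a} {P : Pred A p} (P? : Decidable P) xs →
  length (filter P? xs) + length (filter (∁? P?) xs) ≡ length xs
length-filter-split P? []       = refl
length-filter-split P? (x ∷ xs) with P? x
... | yes _ = cong suc (length-filter-split P? xs)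
... | no  _ = trans (+-suc _ _) (cong suc (length-filter-split P? xs))

-- Proof: the
-- first constraint removes at most r candidates; recurse on the survivors.
avoid : ∀ {a b p} {A : Set a} {B : Set b} (P : B → Pred A p) →
  (∀ t → Decidable (P t)) → (r : ℕ) (Ts : List B) →
  (∀ {t} → t ∈ Ts → ∀ {ys} → Unique ys → All (∁ (P t)) ys → length ys ≤ r) →
  ∀ {xs} → Unique xs → length Ts * r < length xs →
  ∃ λ x → x ∈ xs × (∀ {t} → t ∈ Ts → P t x)
avoid P P? r []       few {x ∷ _} _ _ = x , here refl , λ ()
avoid P P? r (t ∷ Ts) few {xs} u many
  with avoid P P? r Ts (few ∘ there) (UniqueP.filter⁺ (P? t) u) survivors-many
  where
  survivors = filter (P? t) xs
  failures  = filter (∁? (P? t)) xs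

  few-failures : length failures ≤ r
  few-failures = few (here refl) (UniqueP.filter⁺ (∁? (P? t)) u) (AllP.all-filter (∁? (P? t)) xs)

  survivors-many : length Ts * r < length survivors
  survivors-many = +-cancelʳ-≤ r _ _ (begin
    suc (length Ts * r) + r                ≡⟨ cong suc (+-comm (length Ts * r) r) ⟩
    suc (r + length Ts * r)                ≤⟨ many ⟩
    length xs                              ≡⟨ sym (length-filter-split (P? t) xs) ⟩
    length survivors + length failures     ≤⟨ +-monoʳ-≤ (length survivors) few-failures ⟩
    length survivors + r                   ∎)
    where open ≤-Reasoning
... | x , x∈survivors , ok with ∈-filter⁻ (P? t) x∈survivors
... | x∈xs , Ptx = x , x∈xs , λ { (here refl) → Ptx ; (there t∈Ts) → ok t∈Ts }

-- Products in a group

module Products {c ℓ : Level} (G : Group c ℓ) where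
  open Group G using (_≈_; _∙_; ε; setoid) renaming (Carrier to ∣G∣)
  open import Algebra.Properties.Group G using (∙-cancelˡ; ∙-cancelʳ)
  open import Relation.Binary.Reasoning.Setoid setoid

  prod-map : ∀ (b : ℕ → ∣G∣) (g : ℕ → ℕ) ts → prod G (b ∘ g) ts ≡ prod G b (map g ts)
  prod-map b g ts = sym (foldr-map _ g ε ts)

  prod-cong : ∀ {g h : ℕ → ∣G∣} ts → (∀ {j} → j ∈ ts → g j ≡ h j) → prod G g ts ≡ prod G h ts
  prod-cong []       _     = refl
  prod-cong (j ∷ ts) agree = cong₂ _∙_ (agree (here refl)) (prod-cong ts (agree ∘ there))

  prod-cancel : ∀ {g h : ℕ → ∣G∣} {m} ts → Unique ts → m ∈ ts →
    (∀ {j} → j ≢ m → g j ≡ h j) → prod G g ts ≈ prod G h ts → g m ≈ h m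
  prod-cancel {g} {h} {m} (_ ∷ ts) (m∉ts ∷ _) (here refl) agree eq =
    ∙-cancelʳ (prod G g ts) (g m) (h m) (begin
      g m ∙ prod G g ts  ≈⟨ eq ⟩
      h m ∙ prod G h ts  ≡⟨ cong (h m ∙_) (sym (prod-cong ts (λ j∈ts → agree (j≢m j∈ts)))) ⟩
      h m ∙ prod G g ts  ∎)
    where
    j≢m : ∀ {j} → j ∈ ts → j ≢ m
    j≢m j∈ts refl = All.lookup m∉ts j∈ts refl
  prod-cancel {g} {h} {m} (j ∷ ts) (j∉ts ∷ u) (there m∈ts) agree eq =
    prod-cancel ts u m∈ts agree (∙-cancelˡ (g j) _ _ (begin
      g j ∙ prod G g ts  ≈⟨ eq ⟩
      h j ∙ prod G h ts  ≡⟨ cong (_∙ prod G h ts) (sym (agree j≢m)) ⟩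
      g j ∙ prod G h ts  ∎))
    where
    j≢m : j ≢ m
    j≢m refl = All.lookup j∉ts m∈ts refl

-- Index sequences with a fixed finite prefix

_[_↦_] : (ℕ → ℕ) → ℕ → ℕ → ℕ → ℕ
(f [ m ↦ n ]) j with j ≟ m
... | yes _ = n
... | no  _ = f j

update-at : ∀ f m n → (f [ m ↦ n ]) m ≡ n
update-at f m n with m ≟ m
... | yes _   = refl
... | no m≢m = ⊥-elim (m≢m refl)

update-other : ∀ f {m n j} → j ≢ m → (f [ m ↦ n ]) j ≡ f j
update-other f {m} {n} {j} j≢m with j ≟ m
... | yes j≡m = ⊥-elim (j≢m j≡m)
... | no  _   = refl

update-below : ∀ f {m n j} → j < m → (f [ m ↦ n ]) j ≡ f j
update-below f j<m = update-other f (<⇒≢ j<m)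

InjectiveBelow : (ℕ → ℕ) → ℕ → Set
InjectiveBelow f m = ∀ {j j'} → j < m → j' < m → f j ≡ f j' → j ≡ j'

BoundedBelow : (ℕ → ℕ) → ℕ → ℕ → Set
BoundedBelow f m b = ∀ {j} → j < m → f j < b

fresh-value : ∀ {f m b n j} → BoundedBelow f m b → b ≤ n → j < m → f j ≢ n
fresh-value below b≤n j<m = <⇒≢ (<-≤-trans (below j<m) b≤n)

update-injective : ∀ {f m b n} → InjectiveBelow f m → BoundedBelow f m b → b ≤ n →
  InjectiveBelow (f [ m ↦ n ]) (suc m)
update-injective {f} {m} {b} {n} inj below b≤n {j} {j'} j<1+m j'<1+m eq
  with m<1+n⇒m<n∨m≡n j<1+m | m<1+n⇒m<n∨m≡n j'<1+m
... | inj₂ refl | inj₂ refl = refl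
... | inj₁ j<m  | inj₁ j'<m =
  inj j<m j'<m (trans (sym (update-below f j<m)) (trans eq (update-below f j'<m)))
... | inj₁ j<m  | inj₂ refl = ⊥-elim (fresh-value below b≤n j<m
  (trans (sym (update-below f j<m)) (trans eq (update-at f m n))))
... | inj₂ refl | inj₁ j'<m = ⊥-elim (fresh-value below b≤n j'<m
  (trans (sym (update-below f j'<m)) (trans (sym eq) (update-at f m n))))

update-bounded : ∀ {f m b n} → BoundedBelow f m b → b ≤ n → BoundedBelow (f [ m ↦ n ]) (suc m) (suc n)
update-bounded {f} {m} {b} {n} below b≤n {j} j<1+m with m<1+n⇒m<n∨m≡n j<1+m
... | inj₁ j<m = subst (_< suc n) (sym (update-below f j<m)) (m<n⇒m<1+n (<-≤-trans (below j<m) b≤n))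
... | inj₂ refl = subst (_< suc n) (sym (update-at f m n)) ≤-refl

-- The greedy construction

module Construction {c ℓ : Level} (G : Group c ℓ) {k : ℕ} (χ : Colouring G k)
  (a : ℕ → Group.Carrier G) (a-distinct : Distinct G a)
  (col : Fin k) (F : List (Group.Carrier G))
  (almost : ∀ x → InFPhat G a x → Colouring.colour χ x ≡ col ⊎ Any (Group._≈_ G x) F)
  where

  open Group G using (_≈_)
    renaming (Carrier to ∣G∣; reflexive to ≈-reflexive; sym to ≈-sym; trans to ≈-trans)
  open Colouring χ using (colour; colour-≈)
  open Products G

  π : (ℕ → ℕ) → List ℕ → ∣G∣
  π f ts = prod G (a ∘ f) ts

  Good : (ℕ → ℕ) → ℕ → Set
  Good f m = ∀ ts → Admissible G ts → All (_< m) ts → colour (π f ts) ≡ col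

  -- The index lists that must be checked when position m is added.
  Relevant : ℕ → List ℕ → Set
  Relevant m ts = Unique ts × m ∈ ts × All (_< suc m) ts

  relevant? : ∀ m → Decidable (Relevant m)
  relevant? m ts = unique? ts ×-dec (m ∈? ts ×-dec all? (_<? suc m) ts)

  relevantLists : ℕ → List (List ℕ)
  relevantLists m = filter (relevant? m) (boundedLists (suc m) (suc m))

  ∈-relevantLists⁻ : ∀ {m ts} → ts ∈ relevantLists m → Relevant m ts
  ∈-relevantLists⁻ {m} ts∈ = proj₂ (∈-filter⁻ (relevant? m) {xs = boundedLists (suc m) (suc m)} ts∈)

  ∈-relevantLists : ∀ {m ts} → Relevant m ts → ts ∈ relevantLists m
  ∈-relevantLists {m} {ts} rel@(u , _ , ts<1+m) = ∈-filter⁺ (relevant? m)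
    (∈-boundedLists (suc m) (suc m) ts (unique-below-length u ts<1+m) ts<1+m) rel

  module Extension (f : ℕ → ℕ) (m b : ℕ)
    (f-injective : InjectiveBelow f m) (f-below : BoundedBelow f m b) where

    π-injective : ∀ {ts n n'} → Unique ts → m ∈ ts →
      π (f [ m ↦ n ]) ts ≈ π (f [ m ↦ n' ]) ts → n ≡ n'
    π-injective {ts} {n} {n'} u m∈ts eq = a-distinct n n'
      (subst₂ (λ x y → a x ≈ a y) (update-at f m n) (update-at f m n')
        (prod-cancel ts u m∈ts
          (λ j≢m → cong a (trans (update-other f j≢m) (sym (update-other f j≢m)))) eq))

    π-in-FPhat : ∀ {ts n} → Relevant m ts → b ≤ n → InFPhat G a (π (f [ m ↦ n ]) ts)
    π-in-FPhat {ts} {n} (u , m∈ts , ts<1+m) b≤n =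
      map (f [ m ↦ n ]) ts ,
      (unique-map-on (update-injective f-injective f-below b≤n) ts<1+m u ,
       map-nonempty (f [ m ↦ n ]) m∈ts) ,
      ≈-reflexive (prod-map a (f [ m ↦ n ]) ts)

    -- Since miscoloured members of FP-hat(a) lie in F, each relevant list
    -- rules out at most |F| of the fresh choices b + d.
    few-bad : ∀ {ts} → Relevant m ts → ∀ {ds} → Unique ds →
      All (λ d → colour (π (f [ m ↦ b + d ]) ts) ≢ col) ds → length ds ≤ length F
    few-bad {ts} rel@(u , m∈ts , _) uds bad =
      unique-covered-≤ Hits hits-functional uds (All.map lands-in-F bad)
      where
      Hits : ℕ → ∣G∣ → Set ℓ
      Hits d y = π (f [ m ↦ b + d ]) ts ≈ y

      hits-functional : ∀ {d d' y} → Hits d y → Hits d' y → d ≡ d'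
      hits-functional h h' = +-cancelˡ-≡ b _ _ (π-injective u m∈ts (≈-trans h (≈-sym h')))

      lands-in-F : ∀ {d} → colour (π (f [ m ↦ b + d ]) ts) ≢ col → Any (Hits d) F
      lands-in-F {d} miscoloured with almost _ (π-in-FPhat rel (m≤m+n b d))
      ... | inj₁ coloured = ⊥-elim (miscoloured coloured)
      ... | inj₂ hit      = hit

    next-value : Good f m → ∃ λ n → b ≤ n × Good (f [ m ↦ n ]) (suc m)
    next-value good = b + d , m≤m+n b d , extended-good
      where
      Ts = relevantLists m
      K  = suc (length Ts * length F)

      Coloured : List ℕ → ℕ → Set
      Coloured ts d = colour (π (f [ m ↦ b + d ]) ts) ≡ col

      choice : ∃ λ d → d ∈ upTo K × (∀ {ts} → ts ∈ Ts → Coloured ts d)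
      choice = avoid Coloured (λ ts d → colour _ ≟ᶠ col) (length F) Ts
        (few-bad ∘ ∈-relevantLists⁻)
        (UniqueP.upTo⁺ K) (subst (length Ts * length F <_) (sym (length-upTo K)) ≤-refl)

      d = proj₁ choice

      extended-good : Good (f [ m ↦ b + d ]) (suc m)
      extended-good ts adm ts<1+m with m ∈? ts
      ... | yes m∈ts = proj₂ (proj₂ choice) (∈-relevantLists (proj₁ adm , m∈ts , ts<1+m))
      ... | no  m∉ts = trans
        (cong colour (prod-cong ts (λ j∈ts → cong a (update-other f (j≢m j∈ts)))))
        (good ts adm (All.tabulate (λ j∈ts → ≤∧≢⇒< (s≤s⁻¹ (All.lookup ts<1+m j∈ts)) (j≢m j∈ts))))
        where
        j≢m : ∀ {j} → j ∈ ts → j ≢ m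
        j≢m j∈ts refl = m∉ts j∈ts

  record Stage (m : ℕ) : Set where
    field
      seq       : ℕ → ℕ
      bound     : ℕ
      injective : InjectiveBelow seq m
      below     : BoundedBelow seq m bound
      good      : Good seq m

  open Stage

  initial : Stage 0
  initial = record
    { seq = λ _ → 0 ; bound = 0 ; injective = λ () ; below = λ ()
    ; good = λ { [] (_ , ()) _ ; (_ ∷ _) _ (() ∷ _) } }

  next : ∀ {m} (s : Stage m) → ∃ λ n → bound s ≤ n × Good (seq s [ m ↦ n ]) (suc m)
  next {m} s = Extension.next-value (seq s) m (bound s) (injective s) (below s) (good s)

  advance : ∀ {m} → Stage m → Stage (suc m)
  advance {m} s with n , b≤n , good' ← next s = record
    { seq       = seq s [ m ↦ n ]
    ; bound     = suc n
    ; injective = update-injective (injective s) (below s) b≤n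
    ; below     = update-bounded (below s) b≤n
    ; good      = good' }

  stage : ∀ m → Stage m
  stage zero    = initial
  stage (suc m) = advance (stage m)

  i : ℕ → ℕ
  i m = seq (stage (suc m)) m

  stage-stable : ∀ {m j} → j < m → seq (stage m) j ≡ i j
  stage-stable {suc m} {j} j<1+m with m<1+n⇒m<n∨m≡n j<1+m
  ... | inj₁ j<m  = trans (update-below (seq (stage m)) j<m) (stage-stable j<m)
  ... | inj₂ refl = refl

  i-increasing : StrictlyIncreasing i
  i-increasing m = begin-strict
    i m             ≡⟨⟩
    seq s m         <⟨ below s (n<1+n m) ⟩
    bound s         ≤⟨ proj₁ (proj₂ (next s)) ⟩
    proj₁ (next s)  ≡⟨ sym (update-at (seq s) (suc m) (proj₁ (next s))) ⟩
    i (suc m)       ∎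
    where
    s = stage (suc m)
    open ≤-Reasoning

  i-monochromatic : Monochromatic G χ (a ∘ i)
  i-monochromatic = col , λ { x (ts , adm , x≈π) → inFP-coloured x ts adm x≈π }
    where
    inFP-coloured : ∀ x ts → Admissible G ts → x ≈ π i ts → colour x ≡ col
    inFP-coloured x ts adm x≈π with M , ts<M ← upperBound ts = begin
      colour x                       ≡⟨ colour-≈ x≈π ⟩
      colour (π i ts)                ≡⟨ cong colour (prod-cong ts i-agrees) ⟩
      colour (π (seq (stage M)) ts)  ≡⟨ good (stage M) ts adm ts<M ⟩
      col                            ∎
      where
      open ≡-Reasoning
      i-agrees : ∀ {j} → j ∈ ts → a (i j) ≡ a (seq (stage M) j)
      i-agrees j∈ts = cong a (sym (stage-stable (All.lookup ts<M j∈ts)))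

proposition4p2 : {c ℓ : Level} (G : Group c ℓ) → Infinite G →
    (k : ℕ) (χ : Colouring G k) (a : ℕ → Group.Carrier G) →
    Distinct G a → AlmostMonochromatic G χ a →
    Σ (ℕ → ℕ) λ i → StrictlyIncreasing i × Monochromatic G χ (a ∘ i)
proposition4p2 G _ k χ a a-distinct (col , F , almost) = i , i-increasing , i-monochromatic
  where open Construction G χ a a-distinct col F almost
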